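{- Let $n\ge1$ and $\pi_n\in\mathcal{S}_n$. Among the $(n+1)^2$ pairs $(k,\ell)\in\{1,\dots,n+1\}^2$, exactly $(n+1)(n-D(\pi_n))$ satisfy $D(\pi_{n+1}^{(k,\ell)})-D(\pi_n)=1$.
   Context: $\mathcal{S}_n$ is the symmetric group on $\{1,\dots,n\}$; for $\sigma\in\mathcal{S}_m$, $D(\sigma)=\#\{i\le m-1:\sigma(i)>\sigma(i+1)\}$. Insertion at $(k,\ell)\in\{1,\dots,n+1\}^2$: $\pi^{(k,\ell)}_{n+1}\in\mathcal{S}_{n+1}$ is defined by $\pi_{n+1}(k)=\ell$; for $i<k$: $\pi_{n+1}(i)=\pi_n(i)$ if $\pi_n(i)<\ell$ and $\pi_n(i)+1$ otherwise; for $i>k$: $\pi_{n+1}(i)=\pi_n(i-1)$ if $\pi_n(i-1)<\ell$ and $\pi_n(i-1)+1$ otherwise. -}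

module Defs where

open import Data.Nat using (ℕ; zero; suc; _+_; _∸_; _*_)
import Data.Nat
open import Data.Fin using (Fin; zero; suc; toℕ; inject₁; punchIn; punchOut; _<?_; _≟_)
open import Data.Fin.Permutation using (Permutation′; _⟨$⟩ʳ_)
open import Data.List using (List; []; _∷_; length; filter; allFin; cartesianProduct)
open import Data.Product using (_×_; _,_; proj₁; proj₂)
open import Relation.Nullary using (yes; no)
open import Relation.Nullary.Decidable using (does)
open import Data.Bool using (if_then_else_)

-- Permutations are 0-indexed: position/value i ∈ Fin m stands for i+1 ∈ {1..m}.

descF : ∀ {m v} → (Fin (suc m) → Fin v) → ℕ
descF {zero}  σ = 0
descF {suc m} σ =
  (if does (σ (suc zero) <? σ zero) then 1 else 0)
  + descF {m} (λ i → σ (suc i))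

Dfun : ∀ {m} → (Fin m → Fin m) → ℕ
Dfun {zero}  σ = 0
Dfun {suc m} σ = descF σ

D : ∀ {m} → Permutation′ m → ℕ
D π = Dfun (π ⟨$⟩ʳ_)

shiftVal : ∀ {n} → Fin (suc n) → Fin n → Fin (suc n)
shiftVal ℓ v = punchIn ℓ v

-- Insertion π^{(k,ℓ)}_{n+1} as a function Fin (n+1) → Fin (n+1):
--   position k ↦ ℓ;
--   position i ≠ k ↦ shift(π(i')) where i' = i if i < k and i' = i-1 if i > k
--   (i' = punchOut (k ≢ i)).
insert : ∀ {n} → Permutation′ n → Fin (suc n) → Fin (suc n) → Fin (suc n) → Fin (suc n)
insert π k ℓ i with k ≟ i
... | yes _  = ℓ
... | no k≢i = shiftVal ℓ (π ⟨$⟩ʳ punchOut k≢i)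

countUp : ∀ {n} → Permutation′ n → ℕ
countUp {n} π =
  length (filter (λ kl → Data.Nat._≟_ (Dfun (insert π (proj₁ kl) (proj₂ kl))) (suc (D π)))
                 (cartesianProduct (allFin (suc n)) (allFin (suc n))))

-- Inserting ℓ into gap k of xs, with the old entries ≥ ℓ shifted up by one, keeps
-- every adjacent comparison of xs except the one across the gap, between its left
-- neighbour x and right neighbour y; that comparison is replaced by the two comparisons
-- with ℓ. The descent [y < x] is lost and the descents [ℓ ≤ x] and [y < ℓ] are created,
-- and y < x forces at least one of them while both force y < x, so the descent count
-- grows by 0 or 1, namely by [ℓ ≤ x] + [y < ℓ] − [y < x]. Fix ℓ and sum over the n + 1
-- gaps: every entry x is a left neighbour once and a right neighbour once, contributing
-- [ℓ ≤ x] + [x < ℓ] = 1, and every descent is lost once. Hence exactly n − D gaps raise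
-- the descent count, for each of the n + 1 values ℓ.

module Submission where

open import Level using (Level)
open import Defs
open import Function using (_∘_; id)
open import Function.Bundles using (mk⇔)
open import Data.Nat using (ℕ; zero; suc; _+_; _*_; _∸_; _≥_; _≟_; z≤n; s≤s)
open import Data.Nat.Properties
  using (+-*-semiring; +-assoc; +-suc; +-identityʳ; +-cancelʳ-≡; *-identityʳ; 1+n≢n; m+n∸n≡m; <-trans; <-≤-trans; ≤-<-connex; <⇒≱; ≰⇒>)
open import Data.Nat.Solver using (module +-*-Solver)
open import Data.Bool using (if_then_else_)
open import Data.Fin using (Fin; zero; suc; toℕ; punchIn; punchOut; _≤_; _<_; _≤?_; _<?_)
import Data.Fin as Fin
open import Data.Fin.Properties using (punchIn-punchOut)
open import Data.Fin.Permutation using (Permutation′; _⟨$⟩ʳ_)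
open import Data.Vec using (Vec; []; _∷_; map; lookup; tabulate; insertAt)
open import Data.Vec.Properties
  using (lookup-map; lookup∘tabulate; tabulate∘lookup; tabulate-cong; insertAt-lookup; insertAt-punchIn)
import Data.List as List
open import Data.List using (length; filter; cartesianProduct; _++_)
open import Data.List.Properties using (length-++; filter-++; map-tabulate)
open import Data.Product using (_×_; _,_; proj₁; proj₂)
open import Data.Sum using (_⊎_; inj₁; inj₂)
import Data.Sum as Sum
open import Relation.Nullary using (Dec; yes; no; does; ¬_; contradiction)
open import Relation.Nullary.Decidable using (dec-true; dec-false; does-⇔)
open import Relation.Unary using (Decidable)
open import Relation.Binary.PropositionalEquality
open import Algebra.Properties.Semiring.Sum +-*-semiring
  using (sum-syntax; sum-cong-≗; ∑-distrib-+; ∑-comm)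
open +-*-Solver using (solve; _:+_; _:=_; con)

private
  variable
    a b p q r : Level
    A : Set a
    B : Set b
    P : Set p
    Q : Set q
    R : Set r
    m n v : ℕ

𝟙 : Dec P → ℕ
𝟙 P? = if does P? then 1 else 0

𝟙-yes : (P? : Dec P) → P → 𝟙 P? ≡ 1
𝟙-yes P? p = cong (if_then 1 else 0) (dec-true P? p)

𝟙-no : (P? : Dec P) → ¬ P → 𝟙 P? ≡ 0
𝟙-no P? ¬p = cong (if_then 1 else 0) (dec-false P? ¬p)

𝟙≡0⊎𝟙≡1 : (P? : Dec P) → 𝟙 P? ≡ 0 ⊎ 𝟙 P? ≡ 1
𝟙≡0⊎𝟙≡1 (yes _) = inj₂ refl
𝟙≡0⊎𝟙≡1 (no _)  = inj₁ refl

𝟙+𝟙≡1 : (P? : Dec P) (Q? : Dec Q) → (¬ P → Q) → (Q → ¬ P) → 𝟙 P? + 𝟙 Q? ≡ 1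
𝟙+𝟙≡1 (yes p)  (yes q)  _    q⇒¬p = contradiction p (q⇒¬p q)
𝟙+𝟙≡1 (yes _)  (no _)   _    _    = refl
𝟙+𝟙≡1 (no _)   (yes _)  _    _    = refl
𝟙+𝟙≡1 (no ¬p)  (no ¬q)  ¬p⇒q _    = contradiction (¬p⇒q ¬p) ¬q

𝟙+𝟙≡𝟙⊎suc𝟙 : (P? : Dec P) (Q? : Dec Q) (R? : Dec R) → (P → Q → R) → (R → P ⊎ Q) →
             𝟙 P? + 𝟙 Q? ≡ 𝟙 R? ⊎ 𝟙 P? + 𝟙 Q? ≡ suc (𝟙 R?)
𝟙+𝟙≡𝟙⊎suc𝟙 (yes _) (yes _) (yes _) _     _     = inj₂ refl
𝟙+𝟙≡𝟙⊎suc𝟙 (yes p) (yes q) (no ¬r) p⇒q⇒r _     = contradiction (p⇒q⇒r p q) ¬r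
𝟙+𝟙≡𝟙⊎suc𝟙 (yes _) (no _)  (yes _) _     _     = inj₁ refl
𝟙+𝟙≡𝟙⊎suc𝟙 (yes _) (no _)  (no _)  _     _     = inj₂ refl
𝟙+𝟙≡𝟙⊎suc𝟙 (no _)  (yes _) (yes _) _     _     = inj₁ refl
𝟙+𝟙≡𝟙⊎suc𝟙 (no _)  (yes _) (no _)  _     _     = inj₂ refl
𝟙+𝟙≡𝟙⊎suc𝟙 (no ¬p) (no ¬q) (yes r) _     r⇒p∨q with r⇒p∨q r
... | inj₁ p = contradiction p ¬p
... | inj₂ q = contradiction q ¬q
𝟙+𝟙≡𝟙⊎suc𝟙 (no _)  (no _)  (no _)  _     _     = inj₁ refl

𝟙-≟-suc : ∀ {d′ d g c} → d′ + g ≡ d + c → c ≡ g ⊎ c ≡ suc g → 𝟙 (d′ ≟ suc d) + g ≡ c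
𝟙-≟-suc {d′} {d} {g} eq (inj₁ refl) =
  cong (_+ g) (𝟙-no (d′ ≟ suc d) (λ d′≡1+d → 1+n≢n (trans (sym d′≡1+d) (+-cancelʳ-≡ g d′ d eq))))
𝟙-≟-suc {d′} {d} {g} eq (inj₂ refl) =
  cong (_+ g) (𝟙-yes (d′ ≟ suc d) (+-cancelʳ-≡ g d′ (suc d) (trans eq (+-suc d g))))

∑-const : ∀ m c → ∑[ i < m ] c ≡ m * c
∑-const zero    c = refl
∑-const (suc m) c = cong (c +_) (∑-const m c)

length-filter-∷ : ∀ {P : A → Set p} (P? : Decidable P) x xs →
                  length (filter P? (x List.∷ xs)) ≡ 𝟙 (P? x) + length (filter P? xs)
length-filter-∷ P? x xs with P? x
... | yes _ = refl
... | no _  = refl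

length-filter-tabulate : ∀ {P : A → Set p} (P? : Decidable P) (f : Fin m → A) →
                         length (filter P? (List.tabulate f)) ≡ ∑[ i < m ] 𝟙 (P? (f i))
length-filter-tabulate {m = zero}  P? f = refl
length-filter-tabulate {m = suc m} P? f =
  trans (length-filter-∷ P? (f zero) (List.tabulate (f ∘ suc)))
        (cong (𝟙 (P? (f zero)) +_) (length-filter-tabulate P? (f ∘ suc)))

length-filter-cartesianProduct-tabulate :
  ∀ {P : A × B → Set p} (P? : Decidable P) (f : Fin m → A) (g : Fin n → B) →
  length (filter P? (cartesianProduct (List.tabulate f) (List.tabulate g))) ≡
  ∑[ i < m ] ∑[ j < n ] 𝟙 (P? (f i , g j))
length-filter-cartesianProduct-tabulate {m = zero}  P? f g = refl
length-filter-cartesianProduct-tabulate {m = suc m} P? f g = begin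
  length (filter P? (row ++ rest))                 ≡⟨ cong length (filter-++ P? row rest) ⟩
  length (filter P? row ++ filter P? rest)         ≡⟨ length-++ (filter P? row) ⟩
  length (filter P? row) + length (filter P? rest)
    ≡⟨ cong₂ _+_ (trans (cong (length ∘ filter P?) (map-tabulate g (f zero ,_)))
                        (length-filter-tabulate P? ((f zero ,_) ∘ g)))
                 (length-filter-cartesianProduct-tabulate P? (f ∘ suc) g) ⟩
  ∑[ j < _ ] 𝟙 (P? (f zero , g j)) + ∑[ i < m ] ∑[ j < _ ] 𝟙 (P? (f (suc i) , g j)) ∎
  where
  open ≡-Reasoning
  row = List.map (f zero ,_) (List.tabulate g)
  rest = cartesianProduct (List.tabulate (f ∘ suc)) (List.tabulate g)

𝟙-punchIn-<-punchIn : ∀ (i : Fin (suc n)) (x y : Fin n) →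
                      𝟙 (punchIn i x <? punchIn i y) ≡ 𝟙 (x <? y)
𝟙-punchIn-<-punchIn zero    x       y       = refl
𝟙-punchIn-<-punchIn (suc i) zero    zero    = refl
𝟙-punchIn-<-punchIn (suc i) zero    (suc y) = refl
𝟙-punchIn-<-punchIn (suc i) (suc x) zero    = refl
𝟙-punchIn-<-punchIn (suc i) (suc x) (suc y) = 𝟙-punchIn-<-punchIn i x y

𝟙-punchIn-< : ∀ (i : Fin (suc n)) (x : Fin n) → 𝟙 (punchIn i x <? i) ≡ 𝟙 (x <? i)
𝟙-punchIn-< zero    x       = refl
𝟙-punchIn-< (suc i) zero    = refl
𝟙-punchIn-< (suc i) (suc x) = 𝟙-punchIn-< i x

≤⇒<-punchIn : ∀ (i : Fin (suc n)) (x : Fin n) → i ≤ x → i < punchIn i x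
≤⇒<-punchIn zero    x       _         = s≤s z≤n
≤⇒<-punchIn (suc i) (suc x) (s≤s i≤x) = s≤s (≤⇒<-punchIn i x i≤x)

<-punchIn⇒≤ : ∀ (i : Fin (suc n)) (x : Fin n) → i < punchIn i x → i ≤ x
<-punchIn⇒≤ zero    x       _         = z≤n
<-punchIn⇒≤ (suc i) (suc x) (s≤s i<x) = s≤s (<-punchIn⇒≤ i x i<x)

𝟙-<-punchIn : ∀ (i : Fin (suc n)) (x : Fin n) → 𝟙 (i <? punchIn i x) ≡ 𝟙 (i ≤? x)
𝟙-<-punchIn i x = cong (if_then 1 else 0)
  (does-⇔ (mk⇔ (<-punchIn⇒≤ i x) (≤⇒<-punchIn i x)) (i <? punchIn i x) (i ≤? x))

𝟙-≤+𝟙->≡1 : ∀ (i : Fin m) (x : Fin n) → 𝟙 (i ≤? x) + 𝟙 (x <? i) ≡ 1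
𝟙-≤+𝟙->≡1 i x = 𝟙+𝟙≡1 (i ≤? x) (x <? i) ≰⇒> <⇒≱

descents : Vec (Fin v) n → ℕ
descents (x ∷ y ∷ xs) = 𝟙 (y <? x) + descents (y ∷ xs)
descents _            = 0

descents-map-punchIn : ∀ (i : Fin (suc v)) (xs : Vec (Fin v) n) →
                       descents (map (punchIn i) xs) ≡ descents xs
descents-map-punchIn i []           = refl
descents-map-punchIn i (x ∷ [])     = refl
descents-map-punchIn i (x ∷ y ∷ xs) =
  cong₂ _+_ (𝟙-punchIn-<-punchIn i y x) (descents-map-punchIn i (y ∷ xs))

insertShifted : Vec (Fin v) n → Fin (suc n) → Fin (suc v) → Vec (Fin (suc v)) (suc n)
insertShifted xs k ℓ = insertAt (map (punchIn ℓ) xs) k ℓ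

-- Gap k of xs lies between the entries xs[k-1] and xs[k] (when they exist).
leftDescent : Vec (Fin v) n → Fin (suc n) → Fin (suc v) → ℕ
leftDescent xs zero    ℓ = 0
leftDescent xs (suc i) ℓ = 𝟙 (ℓ ≤? lookup xs i)

rightDescent : Vec (Fin v) n → Fin (suc n) → Fin (suc v) → ℕ
rightDescent []       k       ℓ = 0
rightDescent (x ∷ xs) zero    ℓ = 𝟙 (x <? ℓ)
rightDescent (x ∷ xs) (suc k) ℓ = rightDescent xs k ℓ

gapDescent : Vec (Fin v) n → Fin (suc n) → ℕ
gapDescent xs           zero          = 0
gapDescent (x ∷ [])     (suc zero)    = 0
gapDescent (x ∷ y ∷ xs) (suc zero)    = 𝟙 (y <? x)
gapDescent (x ∷ xs)     (suc (suc k)) = gapDescent xs (suc k)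

descents-insertShifted :
  ∀ (xs : Vec (Fin v) n) k ℓ →
  descents (insertShifted xs k ℓ) + gapDescent xs k ≡
  descents xs + (leftDescent xs k ℓ + rightDescent xs k ℓ)
descents-insertShifted [] zero ℓ = refl
descents-insertShifted (x ∷ xs) zero ℓ
  rewrite 𝟙-punchIn-< ℓ x | descents-map-punchIn ℓ (x ∷ xs) =
  solve 2 (λ r d → r :+ d :+ con 0 := d :+ (con 0 :+ r)) refl (𝟙 (x <? ℓ)) (descents (x ∷ xs))
descents-insertShifted (x ∷ []) (suc zero) ℓ
  rewrite 𝟙-<-punchIn ℓ x =
  solve 1 (λ l → l :+ con 0 :+ con 0 := con 0 :+ (l :+ con 0)) refl (𝟙 (ℓ ≤? x))
descents-insertShifted (x ∷ y ∷ xs) (suc zero) ℓ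
  rewrite 𝟙-<-punchIn ℓ x | 𝟙-punchIn-< ℓ y | descents-map-punchIn ℓ (y ∷ xs) =
  solve 4 (λ l r d g → l :+ (r :+ d) :+ g := g :+ d :+ (l :+ r)) refl
    (𝟙 (ℓ ≤? x)) (𝟙 (y <? ℓ)) (descents (y ∷ xs)) (𝟙 (y <? x))
descents-insertShifted (x ∷ y ∷ xs) (suc (suc k)) ℓ = begin
  𝟙 (punchIn ℓ y <? punchIn ℓ x) + descents ys + g  ≡⟨ +-assoc _ (descents ys) g ⟩
  𝟙 (punchIn ℓ y <? punchIn ℓ x) + (descents ys + g)
    ≡⟨ cong₂ _+_ (𝟙-punchIn-<-punchIn ℓ y x) (descents-insertShifted (y ∷ xs) (suc k) ℓ) ⟩
  𝟙 (y <? x) + (descents (y ∷ xs) + c)              ≡⟨ +-assoc (𝟙 (y <? x)) (descents (y ∷ xs)) c ⟨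
  𝟙 (y <? x) + descents (y ∷ xs) + c                ∎
  where
  open ≡-Reasoning
  ys = insertShifted (y ∷ xs) (suc k) ℓ
  g = gapDescent (y ∷ xs) (suc k)
  c = leftDescent (y ∷ xs) (suc k) ℓ + rightDescent (y ∷ xs) (suc k) ℓ

leftDescent+rightDescent≡gapDescent⊎suc :
  ∀ (xs : Vec (Fin v) n) k ℓ →
  leftDescent xs k ℓ + rightDescent xs k ℓ ≡ gapDescent xs k ⊎
  leftDescent xs k ℓ + rightDescent xs k ℓ ≡ suc (gapDescent xs k)
leftDescent+rightDescent≡gapDescent⊎suc []       zero ℓ = inj₁ refl
leftDescent+rightDescent≡gapDescent⊎suc (x ∷ xs) zero ℓ = 𝟙≡0⊎𝟙≡1 (x <? ℓ)
leftDescent+rightDescent≡gapDescent⊎suc (x ∷ []) (suc zero) ℓ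
  rewrite +-identityʳ (𝟙 (ℓ ≤? x)) = 𝟙≡0⊎𝟙≡1 (ℓ ≤? x)
leftDescent+rightDescent≡gapDescent⊎suc (x ∷ y ∷ xs) (suc zero) ℓ =
  𝟙+𝟙≡𝟙⊎suc𝟙 (ℓ ≤? x) (y <? ℓ) (y <? x)
    (λ ℓ≤x y<ℓ → <-≤-trans y<ℓ ℓ≤x)
    (λ y<x → Sum.map₂ (<-trans y<x) (≤-<-connex (toℕ ℓ) (toℕ x)))
leftDescent+rightDescent≡gapDescent⊎suc (x ∷ y ∷ xs) (suc (suc k)) ℓ =
  leftDescent+rightDescent≡gapDescent⊎suc (y ∷ xs) (suc k) ℓ

raisesDescents : Vec (Fin v) n → Fin (suc n) → Fin (suc v) → ℕ
raisesDescents xs k ℓ = 𝟙 (descents (insertShifted xs k ℓ) ≟ suc (descents xs))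

raisesDescents+gapDescent :
  ∀ (xs : Vec (Fin v) n) k ℓ →
  raisesDescents xs k ℓ + gapDescent xs k ≡ leftDescent xs k ℓ + rightDescent xs k ℓ
raisesDescents+gapDescent xs k ℓ =
  𝟙-≟-suc (descents-insertShifted xs k ℓ) (leftDescent+rightDescent≡gapDescent⊎suc xs k ℓ)

∑-gapDescent : ∀ (xs : Vec (Fin v) n) → ∑[ k < suc n ] gapDescent xs k ≡ descents xs
∑-gapDescent []           = refl
∑-gapDescent (x ∷ [])     = refl
∑-gapDescent (x ∷ y ∷ xs) = cong (𝟙 (y <? x) +_) (∑-gapDescent (y ∷ xs))

∑-rightDescent : ∀ (xs : Vec (Fin v) n) ℓ →
                 ∑[ k < suc n ] rightDescent xs k ℓ ≡ ∑[ i < n ] 𝟙 (lookup xs i <? ℓ)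
∑-rightDescent []       ℓ = refl
∑-rightDescent (x ∷ xs) ℓ = cong (𝟙 (x <? ℓ) +_) (∑-rightDescent xs ℓ)

∑-leftDescent+rightDescent : ∀ (xs : Vec (Fin v) n) ℓ →
                             ∑[ k < suc n ] (leftDescent xs k ℓ + rightDescent xs k ℓ) ≡ n
∑-leftDescent+rightDescent {n = n} xs ℓ = begin
  ∑[ k < suc n ] (leftDescent xs k ℓ + rightDescent xs k ℓ)
    ≡⟨ ∑-distrib-+ (λ k → leftDescent xs k ℓ) (λ k → rightDescent xs k ℓ) ⟩
  ∑[ i < n ] 𝟙 (ℓ ≤? lookup xs i) + ∑[ k < suc n ] rightDescent xs k ℓ
    ≡⟨ cong (∑[ i < n ] 𝟙 (ℓ ≤? lookup xs i) +_) (∑-rightDescent xs ℓ) ⟩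
  ∑[ i < n ] 𝟙 (ℓ ≤? lookup xs i) + ∑[ i < n ] 𝟙 (lookup xs i <? ℓ)
    ≡⟨ ∑-distrib-+ (λ i → 𝟙 (ℓ ≤? lookup xs i)) (λ i → 𝟙 (lookup xs i <? ℓ)) ⟨
  ∑[ i < n ] (𝟙 (ℓ ≤? lookup xs i) + 𝟙 (lookup xs i <? ℓ))
    ≡⟨ sum-cong-≗ (λ i → 𝟙-≤+𝟙->≡1 ℓ (lookup xs i)) ⟩
  ∑[ i < n ] 1
    ≡⟨ ∑-const n 1 ⟩
  n * 1
    ≡⟨ *-identityʳ n ⟩
  n ∎
  where open ≡-Reasoning

∑-raisesDescents : ∀ (xs : Vec (Fin v) n) ℓ →
                   ∑[ k < suc n ] raisesDescents xs k ℓ ≡ n ∸ descents xs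
∑-raisesDescents {n = n} xs ℓ = begin
  s                             ≡⟨ m+n∸n≡m s (descents xs) ⟨
  s + descents xs ∸ descents xs ≡⟨ cong (_∸ descents xs) s+descents≡n ⟩
  n ∸ descents xs               ∎
  where
  open ≡-Reasoning
  s = ∑[ k < suc n ] raisesDescents xs k ℓ
  s+descents≡n : s + descents xs ≡ n
  s+descents≡n = begin
    s + descents xs                              ≡⟨ cong (s +_) (∑-gapDescent xs) ⟨
    s + ∑[ k < suc n ] gapDescent xs k
      ≡⟨ ∑-distrib-+ (λ k → raisesDescents xs k ℓ) (gapDescent xs) ⟨
    ∑[ k < suc n ] (raisesDescents xs k ℓ + gapDescent xs k)
      ≡⟨ sum-cong-≗ (λ k → raisesDescents+gapDescent xs k ℓ) ⟩
    ∑[ k < suc n ] (leftDescent xs k ℓ + rightDescent xs k ℓ)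
      ≡⟨ ∑-leftDescent+rightDescent xs ℓ ⟩
    n                                            ∎

∑∑-raisesDescents : ∀ (xs : Vec (Fin v) n) →
                    ∑[ k < suc n ] ∑[ ℓ < suc v ] raisesDescents xs k ℓ ≡ suc v * (n ∸ descents xs)
∑∑-raisesDescents {v = v} {n = n} xs = begin
  ∑[ k < suc n ] ∑[ ℓ < suc v ] raisesDescents xs k ℓ ≡⟨ ∑-comm (raisesDescents xs) ⟩
  ∑[ ℓ < suc v ] ∑[ k < suc n ] raisesDescents xs k ℓ ≡⟨ sum-cong-≗ (∑-raisesDescents xs) ⟩
  ∑[ ℓ < suc v ] (n ∸ descents xs)                    ≡⟨ ∑-const (suc v) (n ∸ descents xs) ⟩
  suc v * (n ∸ descents xs)                           ∎
  where open ≡-Reasoning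

descF-tabulate : ∀ (σ : Fin (suc m) → Fin v) → descF σ ≡ descents (tabulate σ)
descF-tabulate {zero}  σ = refl
descF-tabulate {suc m} σ = cong (𝟙 (σ (suc zero) <? σ zero) +_) (descF-tabulate (σ ∘ suc))

Dfun-tabulate : ∀ (σ : Fin m → Fin m) → Dfun σ ≡ descents (tabulate σ)
Dfun-tabulate {zero}  σ = refl
Dfun-tabulate {suc m} σ = descF-tabulate σ

insert≗lookup-insertShifted : ∀ (π : Permutation′ n) k ℓ i →
  insert π k ℓ i ≡ lookup (insertShifted (tabulate (π ⟨$⟩ʳ_)) k ℓ) i
insert≗lookup-insertShifted π k ℓ i with k Fin.≟ i
... | yes refl = sym (insertAt-lookup (map (punchIn ℓ) (tabulate (π ⟨$⟩ʳ_))) k ℓ)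
... | no k≢i = begin
  punchIn ℓ (π ⟨$⟩ʳ j)                       ≡⟨ cong (punchIn ℓ) (lookup∘tabulate (π ⟨$⟩ʳ_) j) ⟨
  punchIn ℓ (lookup xs j)                    ≡⟨ lookup-map j (punchIn ℓ) xs ⟨
  lookup (map (punchIn ℓ) xs) j              ≡⟨ insertAt-punchIn (map (punchIn ℓ) xs) k ℓ j ⟨
  lookup (insertShifted xs k ℓ) (punchIn k j) ≡⟨ cong (lookup (insertShifted xs k ℓ)) (punchIn-punchOut k≢i) ⟩
  lookup (insertShifted xs k ℓ) i            ∎
  where
  open ≡-Reasoning
  xs = tabulate (π ⟨$⟩ʳ_)
  j = punchOut k≢i

Dfun-insert : ∀ (π : Permutation′ n) k ℓ →
              Dfun (insert π k ℓ) ≡ descents (insertShifted (tabulate (π ⟨$⟩ʳ_)) k ℓ)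
Dfun-insert π k ℓ = begin
  Dfun (insert π k ℓ)                   ≡⟨ Dfun-tabulate (insert π k ℓ) ⟩
  descents (tabulate (insert π k ℓ))    ≡⟨ cong descents (tabulate-cong (insert≗lookup-insertShifted π k ℓ)) ⟩
  descents (tabulate (lookup ys))       ≡⟨ cong descents (tabulate∘lookup ys) ⟩
  descents ys                           ∎
  where
  open ≡-Reasoning
  ys = insertShifted (tabulate (π ⟨$⟩ʳ_)) k ℓ

corollary7p2 : (n : ℕ) → n ≥ 1 → (π : Permutation′ n) →
    countUp π ≡ suc n * (n ∸ D π)
corollary7p2 n _ π = begin
  countUp π
    ≡⟨ length-filter-cartesianProduct-tabulate (λ kl → Dfun (insert π (proj₁ kl) (proj₂ kl)) ≟ suc (D π)) id id ⟩
  ∑[ k < suc n ] ∑[ ℓ < suc n ] 𝟙 (Dfun (insert π k ℓ) ≟ suc (D π))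
    ≡⟨ sum-cong-≗ (λ k → sum-cong-≗ (λ ℓ →
         cong₂ (λ d′ d → 𝟙 (d′ ≟ suc d)) (Dfun-insert π k ℓ) (Dfun-tabulate (π ⟨$⟩ʳ_)))) ⟩
  ∑[ k < suc n ] ∑[ ℓ < suc n ] raisesDescents xs k ℓ
    ≡⟨ ∑∑-raisesDescents xs ⟩
  suc n * (n ∸ descents xs)
    ≡⟨ cong (λ d → suc n * (n ∸ d)) (Dfun-tabulate (π ⟨$⟩ʳ_)) ⟨
  suc n * (n ∸ D π) ∎
  where
  open ≡-Reasoning
  xs = tabulate (π ⟨$⟩ʳ_)
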